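{- Let $n$ be a positive integer and $b>1$ an integer. If the base-$b$ representation of $N=2^n$ is palindromic and has an even number of digits, then $b=2^x-1$ for some integer $x$.
   Context: For an integer $b>1$, every positive integer $N$ can be written uniquely as $N=\sum_{i=0}^m c_i b^i$ with integers $0\le c_i<b$ and $c_m>0$; this is written $N=(c_m,\ldots,c_0)_b$ and has $m+1$ digits. The representation is palindromic if $c_j=c_{m-j}$ for all $j=0,\ldots,m$. -}

module Defs where

open import Data.Nat using (ℕ; zero; suc; _+_; _*_; _<_)
open import Data.List using (List; []; _∷_; reverse; last)
open import Data.List.Relation.Unary.All using (All)
open import Data.Maybe using (Maybe; just; nothing)
open import Data.Product using (Σ; _×_)
open import Relation.Binary.PropositionalEquality using (_≡_)

-- Value of a digit list, LEAST significant digit first: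
-- value b (c₀ ∷ c₁ ∷ … ∷ cₘ ∷ []) = Σ cᵢ bⁱ
value : ℕ → List ℕ → ℕ
value b []       = 0
value b (c ∷ cs) = c + b * value b cs

LeadingPositive : List ℕ → Set
LeadingPositive cs = Σ ℕ (λ c → (last cs ≡ just c) × (0 < c))

IsBaseRep : ℕ → ℕ → List ℕ → Set
IsBaseRep b N ds = All (_< b) ds × LeadingPositive ds × (value b ds ≡ N)

Palindromic : List ℕ → Set
Palindromic ds = reverse ds ≡ ds

-- Since b ≡ −1 modulo b + 1, the value of a digit list is congruent to its alternating
-- digit sum.  Reversing a list of even length negates that sum, so for an even-length
-- palindrome it vanishes and b + 1 divides N = 2ⁿ.  A divisor of a prime power is a
-- power of that prime, hence b + 1 = 2ˣ.
module Submission where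

open import Defs
open import Data.Nat using (ℕ; _<_; _^_; _∸_)
open import Data.Nat.Divisibility using (_∣_)
open import Data.List using (List; length)
open import Data.Product using (∃)
open import Relation.Binary.PropositionalEquality using (_≡_)

open import Data.Nat as ℕ using (zero; suc)
import Data.Nat.Properties as ℕ
open import Data.Nat.Divisibility using (_∤_; divides; _∣?_; ∣1⇒≡1; *-cancelʳ-∣)
import Data.Nat.Coprimality as Coprimality
open Coprimality using (Coprime; coprime-divisor)
open import Data.Nat.Primality using (Prime; prime[2]; prime⇒nonZero; prime⇒irreducible)
open import Data.Integer as ℤ using (ℤ; +_; -[1+_]; -_; 0ℤ; -1ℤ; ∣_∣)
import Data.Integer.Properties as ℤ
open import Data.Integer.Solver using (module +-*-Solver)
open import Data.List using ([]; _∷_; _++_; [_]; reverse)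
open import Data.List.Properties using (length-reverse; unfold-reverse)
open import Data.Product using (_,_)
open import Data.Sum using (inj₁; inj₂)
open import Relation.Nullary using (yes; no; contradiction)
open import Relation.Binary.PropositionalEquality
  using (refl; sym; trans; cong; cong₂; subst; module ≡-Reasoning)

open +-*-Solver

∤⇒coprime : ∀ {p d} → Prime p → p ∤ d → Coprime p d
∤⇒coprime p-prime p∤d (i∣p , i∣d) with prime⇒irreducible p-prime i∣p
... | inj₁ i≡1 = i≡1
... | inj₂ refl = contradiction i∣d p∤d

∣p^n⇒≡p^x : ∀ {p d} n → Prime p → d ∣ p ^ n → ∃ λ x → d ≡ p ^ x
∣p^n⇒≡p^x zero _ d∣1 = 0 , ∣1⇒≡1 d∣1
∣p^n⇒≡p^x {p} {d} (suc n) p-prime d∣p^1+n with p ∣? d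
... | no p∤d =
  ∣p^n⇒≡p^x n p-prime
    (coprime-divisor (Coprimality.sym (∤⇒coprime p-prime p∤d)) d∣p^1+n)
... | yes (divides q refl) with ∣p^n⇒≡p^x n p-prime q∣p^n
  where
  q∣p^n : q ∣ p ^ n
  q∣p^n = *-cancelʳ-∣ p {{prime⇒nonZero p-prime}}
            (subst (q ℕ.* p ∣_) (ℕ.*-comm p (p ^ n)) d∣p^1+n)
...   | x , refl = suc x , ℕ.*-comm (p ^ x) p

alternatingSum : List ℕ → ℤ
alternatingSum []       = 0ℤ
alternatingSum (c ∷ cs) = + c ℤ.- alternatingSum cs

value≡alternatingSum+multiple : ∀ b cs →
  ∃ λ q → + value b cs ≡ alternatingSum cs ℤ.+ + suc b ℤ.* q
value≡alternatingSum+multiple b [] = 0ℤ , sym (trans (ℤ.+-identityˡ _) (ℤ.*-zeroʳ (+ suc b)))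
value≡alternatingSum+multiple b (c ∷ cs) with value≡alternatingSum+multiple b cs
... | q , value≡ = alternatingSum cs ℤ.+ + b ℤ.* q , (begin
  + (c ℕ.+ b ℕ.* value b cs)                 ≡⟨ ℤ.pos-+ c (b ℕ.* value b cs) ⟩
  + c ℤ.+ + (b ℕ.* value b cs)               ≡⟨ cong (ℤ._+_ (+ c)) (ℤ.pos-* b (value b cs)) ⟩
  + c ℤ.+ + b ℤ.* + value b cs               ≡⟨ cong (λ v → + c ℤ.+ + b ℤ.* v) value≡ ⟩
  + c ℤ.+ + b ℤ.* (a ℤ.+ + suc b ℤ.* q)       ≡⟨ solve 4 (λ c b a q →
      c :+ b :* (a :+ (con (+ 1) :+ b) :* q)
        := (c :- a) :+ (con (+ 1) :+ b) :* (a :+ b :* q)) refl (+ c) (+ b) a q ⟩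
  (+ c ℤ.- a) ℤ.+ + suc b ℤ.* (a ℤ.+ + b ℤ.* q) ∎)
  where
  open ≡-Reasoning
  a : ℤ
  a = alternatingSum cs

alternatingSum-++ : ∀ xs ys →
  alternatingSum (xs ++ ys) ≡ alternatingSum xs ℤ.+ -1ℤ ℤ.^ length xs ℤ.* alternatingSum ys
alternatingSum-++ []       ys = sym (trans (ℤ.+-identityˡ _) (ℤ.*-identityˡ (alternatingSum ys)))
alternatingSum-++ (x ∷ xs) ys rewrite alternatingSum-++ xs ys =
  solve 4 (λ x a s b → x :- (a :+ s :* b) := (x :- a) :+ (con -1ℤ :* s) :* b)
    refl (+ x) (alternatingSum xs) (-1ℤ ℤ.^ length xs) (alternatingSum ys)

alternatingSum-reverse : ∀ xs →
  alternatingSum (reverse xs) ≡ - (-1ℤ ℤ.^ length xs ℤ.* alternatingSum xs)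
alternatingSum-reverse []       = refl
alternatingSum-reverse (x ∷ xs) = begin
  alternatingSum (reverse (x ∷ xs))              ≡⟨ cong alternatingSum (unfold-reverse x xs) ⟩
  alternatingSum (reverse xs ++ [ x ])           ≡⟨ alternatingSum-++ (reverse xs) [ x ] ⟩
  alternatingSum (reverse xs) ℤ.+ -1ℤ ℤ.^ length (reverse xs) ℤ.* (+ x ℤ.- 0ℤ)
    ≡⟨ cong₂ (λ u n → u ℤ.+ -1ℤ ℤ.^ n ℤ.* (+ x ℤ.- 0ℤ)) (alternatingSum-reverse xs) (length-reverse xs) ⟩
  - (s ℤ.* a) ℤ.+ s ℤ.* (+ x ℤ.- 0ℤ)
    ≡⟨ solve 3 (λ s a x → :- (s :* a) :+ s :* (x :- con 0ℤ) := :- ((con -1ℤ :* s) :* (x :- a)))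
         refl s a (+ x) ⟩
  - (-1ℤ ℤ.* s ℤ.* (+ x ℤ.- a))                  ∎
  where
  open ≡-Reasoning
  s a : ℤ
  s = -1ℤ ℤ.^ length xs
  a = alternatingSum xs

-1^even≡1 : ∀ k → -1ℤ ℤ.^ (k ℕ.* 2) ≡ + 1
-1^even≡1 k = begin
  -1ℤ ℤ.^ (k ℕ.* 2)        ≡⟨ cong (-1ℤ ℤ.^_) (ℕ.*-comm k 2) ⟩
  -1ℤ ℤ.^ (2 ℕ.* k)        ≡⟨ ℤ.^-*-assoc -1ℤ 2 k ⟨
  (-1ℤ ℤ.^ 2) ℤ.^ k        ≡⟨ ℤ.^-zeroˡ k ⟩
  + 1                      ∎
  where open ≡-Reasoning

i≡-i⇒i≡0 : ∀ {i} → i ≡ - i → i ≡ 0ℤ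
i≡-i⇒i≡0 {+ zero}    _ = refl
i≡-i⇒i≡0 {+ suc _}   ()
i≡-i⇒i≡0 { -[1+ _ ]} ()

evenPalindrome⇒alternatingSum≡0 : ∀ {ds} → Palindromic ds → 2 ∣ length ds →
  alternatingSum ds ≡ 0ℤ
evenPalindrome⇒alternatingSum≡0 {ds} palindromic (divides k |ds|≡k*2) = i≡-i⇒i≡0 (begin
  alternatingSum ds                              ≡⟨ cong alternatingSum palindromic ⟨
  alternatingSum (reverse ds)                    ≡⟨ alternatingSum-reverse ds ⟩
  - (-1ℤ ℤ.^ length ds ℤ.* alternatingSum ds)    ≡⟨ cong (λ n → - (-1ℤ ℤ.^ n ℤ.* alternatingSum ds)) |ds|≡k*2 ⟩
  - (-1ℤ ℤ.^ (k ℕ.* 2) ℤ.* alternatingSum ds)    ≡⟨ cong (λ s → - (s ℤ.* alternatingSum ds)) (-1^even≡1 k) ⟩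
  - (+ 1 ℤ.* alternatingSum ds)                  ≡⟨ cong -_ (ℤ.*-identityˡ (alternatingSum ds)) ⟩
  - alternatingSum ds                            ∎)
  where open ≡-Reasoning

evenPalindrome⇒1+b∣value : ∀ b {ds} → Palindromic ds → 2 ∣ length ds → suc b ∣ value b ds
evenPalindrome⇒1+b∣value b {ds} palindromic even with value≡alternatingSum+multiple b ds
... | q , value≡ = divides ∣ q ∣ (begin
  value b ds                                     ≡⟨ cong ∣_∣ value≡ ⟩
  ∣ alternatingSum ds ℤ.+ + suc b ℤ.* q ∣        ≡⟨ cong (λ a → ∣ a ℤ.+ + suc b ℤ.* q ∣) alternatingSum≡0 ⟩
  ∣ 0ℤ ℤ.+ + suc b ℤ.* q ∣                       ≡⟨ cong ∣_∣ (ℤ.+-identityˡ (+ suc b ℤ.* q)) ⟩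
  ∣ + suc b ℤ.* q ∣                              ≡⟨ ℤ.abs-* (+ suc b) q ⟩
  suc b ℕ.* ∣ q ∣                                ≡⟨ ℕ.*-comm (suc b) ∣ q ∣ ⟩
  ∣ q ∣ ℕ.* suc b                                ∎)
  where
  open ≡-Reasoning
  alternatingSum≡0 : alternatingSum ds ≡ 0ℤ
  alternatingSum≡0 = evenPalindrome⇒alternatingSum≡0 palindromic even

corollary2p1 : (n b : ℕ) → 0 < n → 1 < b → (ds : List ℕ) →
    IsBaseRep b (2 ^ n) ds → Palindromic ds → 2 ∣ length ds →
    ∃ λ x → b ≡ 2 ^ x ∸ 1
corollary2p1 n b _ _ ds (_ , _ , value≡2^n) palindromic even
  with ∣p^n⇒≡p^x n prime[2]
         (subst (suc b ∣_) value≡2^n (evenPalindrome⇒1+b∣value b palindromic even))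
... | x , 1+b≡2^x = x , cong (_∸ 1) 1+b≡2^x
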